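{- Let $S=\{s_n\}_{n\ge1}$ and $T=\{t_n\}_{n\ge1}$ be increasing sequences (finite or infinite) of positive odd integers with $S\subseteq T$ (as sets of terms). Let $S(y)=\#\{n: s_n\le y\}$ and $T(y)=\#\{n:t_n\le y\}$ be their counting functions. For a positive even integer $x$, let $g(x)$ be the number of pairs $(a,b)$ of integers with $a\le b$, $a+b=x$, such that ($a\in S$ and $b\in T$) or ($a\in T$ and $b\in S$) (i.e., the number of solutions of $x=s+t$, $s\in S$, $t\in T$, with order of summands unimportant). Then for every even $x\ge4$, $$g(x)=\sum_{t\in T,\ t\le x/2}S(x-t)+\sum_{s\in S,\ s\le x/2}\bigl(T(x-s)-S(x-s)\bigr)-S(x/2)\,T(x/2)+\binom{S(x/2)+1}{2}-g(x-2)-g(x-4)-\dots-g(2).$$ -}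

module Defs where

open import Data.Nat using (ℕ; zero; suc; _+_; _*_; _∸_; _%_)
open import Data.Bool using (Bool; true; false; if_then_else_)
open import Data.Product using (∃)
import Data.Integer
open import Relation.Binary.PropositionalEquality using (_≡_)

-- A (finite or infinite) increasing sequence of positive integers is
-- identified with its set of terms, given as a Boolean predicate on ℕ.
SeqSet : Set
SeqSet = ℕ → Bool

Odd : ℕ → Set
Odd n = n % 2 ≡ 1

Even : ℕ → Set
Even n = ∃ λ m → n ≡ 2 * m

ind : Bool → ℕ
ind true  = 1
ind false = 0

Σ≤ : ℕ → (ℕ → ℕ) → ℕ
Σ≤ zero    f = f 0
Σ≤ (suc n) f = Σ≤ n f + f (suc n)

count : SeqSet → ℕ → ℕ
count P y = Σ≤ y (λ n → ind (P n))

g : SeqSet → SeqSet → ℕ → ℕ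
g S T x = Σ≤ (Data.Nat._/_ x 2)
  (λ a → ind (Data.Bool._∨_ (Data.Bool._∧_ (S a) (T (x ∸ a)))
                            (Data.Bool._∧_ (T a) (S (x ∸ a)))))

ΣZ≤ : ℕ → (ℕ → Data.Integer.ℤ) → Data.Integer.ℤ
ΣZ≤ zero    f = f 0
ΣZ≤ (suc n) f = Data.Integer._+_ (ΣZ≤ n f) (f (suc n))

-- Write x = 2h. The right-hand side without the final sum, viewed as a function A(h), counts
-- the unordered pairs {s, t} with s ∈ S, t ∈ T and s + t ≤ 2h, so A(h) = g(2) + g(4) + ⋯ + g(2h).
-- We prove A(h + 1) = A(h) + g(2h + 2) summand by summand: passing from 2h to 2h + 2 shifts every
-- partner 2h − i by two, and the skipped value 2h + 1 − i is even whenever i is odd, so it never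
-- lies in S or T. The pair indices i ≤ h then contribute exactly the terms of g(2h + 2), while
-- the new index h + 1 is balanced by the changes of S(h)T(h) and binom(S(h) + 1, 2).
module Submission where

open import Defs
open import Data.Nat using (ℕ; _∸_; _≤_; _/_)
open import Data.Nat.Combinatorics using (_C_)
open import Data.Integer using (ℤ; +_; _+_; _-_; _*_; 0ℤ)
open import Data.Bool using (true; if_then_else_)
open import Relation.Binary.PropositionalEquality using (_≡_)
open import Data.Product using (_×_)

import Data.Nat as N
open N using (zero; suc; z≤n; s≤s)
import Data.Nat.Properties as Nₚ
import Data.Integer.Properties as ℤₚ
open import Data.Nat.DivMod using (m*n/n≡m; %-distribˡ-+; [m+kn]%n≡m%n)
open import Data.Nat.Combinatorics using (nC1≡n; nCk+nC[k+1]≡[n+1]C[k+1])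
open import Data.Bool using (Bool; false; _∧_; _∨_)
open import Data.Empty using (⊥-elim)
open import Data.Product using (_,_; proj₁)
open import Function using (_∘_)
open import Relation.Binary.PropositionalEquality
  using (_≢_; refl; sym; trans; cong; cong₂; module ≡-Reasoning)
open import Data.Integer.Tactic.RingSolver using (solve-∀)

open ≡-Reasoning

χ : Bool → ℤ
χ b = + ind b

OddSupported : SeqSet → Set
OddSupported P = ∀ n → P n ≡ true → Odd n

+Σ≤≡ΣZ≤ : ∀ n f → + Σ≤ n f ≡ ΣZ≤ n (+_ ∘ f)
+Σ≤≡ΣZ≤ zero    f = refl
+Σ≤≡ΣZ≤ (suc n) f = cong (_+ + f (suc n)) (+Σ≤≡ΣZ≤ n f)

ΣZ≤-cong : ∀ n {f h : ℕ → ℤ} → (∀ i → i ≤ n → f i ≡ h i) → ΣZ≤ n f ≡ ΣZ≤ n h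
ΣZ≤-cong zero    f≡h = f≡h 0 z≤n
ΣZ≤-cong (suc n) f≡h =
  cong₂ _+_ (ΣZ≤-cong n (λ i i≤n → f≡h i (Nₚ.m≤n⇒m≤1+n i≤n))) (f≡h (suc n) Nₚ.≤-refl)

ΣZ≤-distrib-+ : ∀ n (f h : ℕ → ℤ) → ΣZ≤ n (λ i → f i + h i) ≡ ΣZ≤ n f + ΣZ≤ n h
ΣZ≤-distrib-+ zero    f h = refl
ΣZ≤-distrib-+ (suc n) f h = begin
  ΣZ≤ n (λ i → f i + h i) + (f (suc n) + h (suc n))
    ≡⟨ cong (_+ (f (suc n) + h (suc n))) (ΣZ≤-distrib-+ n f h) ⟩
  ΣZ≤ n f + ΣZ≤ n h + (f (suc n) + h (suc n))
    ≡⟨ interchange (ΣZ≤ n f) (ΣZ≤ n h) (f (suc n)) (h (suc n)) ⟩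
  ΣZ≤ n f + f (suc n) + (ΣZ≤ n h + h (suc n)) ∎
  where
  interchange : ∀ a b c d → a + b + (c + d) ≡ a + c + (b + d)
  interchange = solve-∀

count-skip : ∀ P y → P (suc y) ≡ false →
             count P (suc (suc y)) ≡ count P y N.+ ind (P (suc (suc y)))
count-skip P y Py+1≡false rewrite Py+1≡false =
  cong (N._+ ind (P (suc (suc y)))) (Nₚ.+-identityʳ (count P y))

2*n/2≡n : ∀ n → 2 N.* n / 2 ≡ n
2*n/2≡n n = trans (cong (_/ 2) (Nₚ.*-comm 2 n)) (m*n/n≡m n 2)

2*n∸n≡n : ∀ n → 2 N.* n ∸ n ≡ n
2*n∸n≡n n = trans (Nₚ.m+n∸m≡n n (n N.+ 0)) (Nₚ.+-identityʳ n)

2*[1+h]∸i≡2+[2*h∸i] : ∀ h i → i ≤ 2 N.* h → 2 N.* suc h ∸ i ≡ suc (suc (2 N.* h ∸ i))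
2*[1+h]∸i≡2+[2*h∸i] h i i≤2h = trans (cong (_∸ i) (Nₚ.*-suc 2 h)) (Nₚ.+-∸-assoc 2 i≤2h)

odd-supported-0 : ∀ {P} → OddSupported P → P 0 ≡ false
odd-supported-0 {P} oddP with P 0 in P0
... | false = refl
... | true with oddP 0 P0
...   | ()

odd+odd≢1+2*h : ∀ {i j} h → Odd i → Odd j → i N.+ j ≢ suc (2 N.* h)
odd+odd≢1+2*h {i} {j} h oddi oddj i+j≡2h+1 with () ← begin
  0                           ≡⟨ cong₂ (λ u v → (u N.+ v) N.% 2) oddi oddj ⟨
  (i N.% 2 N.+ j N.% 2) N.% 2 ≡⟨ %-distribˡ-+ i j 2 ⟨
  (i N.+ j) N.% 2             ≡⟨ cong (N._% 2) i+j≡2h+1 ⟩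
  suc (2 N.* h) N.% 2         ≡⟨ cong (λ m → suc m N.% 2) (Nₚ.*-comm 2 h) ⟩
  (1 N.+ h N.* 2) N.% 2       ≡⟨ [m+kn]%n≡m%n 1 h 2 ⟩
  1 ∎

no-odd-partner : ∀ {P i} h → OddSupported P → Odd i → i ≤ 2 N.* h →
                 P (suc (2 N.* h ∸ i)) ≡ false
no-odd-partner {P} {i} h oddP oddi i≤2h with P (suc (2 N.* h ∸ i)) in Pj
... | false = refl
... | true = ⊥-elim (odd+odd≢1+2*h {i} {suc (2 N.* h ∸ i)} h oddi (oddP _ Pj)
                       (trans (Nₚ.+-suc i _) (cong suc (Nₚ.m+[n∸m]≡n i≤2h))))

[n+2]C2≡[n+1]C2+[n+1] : ∀ n → (n N.+ 1 N.+ 1) C 2 ≡ (n N.+ 1) C 2 N.+ (n N.+ 1)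
[n+2]C2≡[n+1]C2+[n+1] n = begin
  (n N.+ 1 N.+ 1) C 2                ≡⟨ cong (_C 2) (Nₚ.+-comm (n N.+ 1) 1) ⟩
  suc (n N.+ 1) C 2                  ≡⟨ nCk+nC[k+1]≡[n+1]C[k+1] (n N.+ 1) 1 ⟨
  (n N.+ 1) C 1 N.+ (n N.+ 1) C 2    ≡⟨ cong (N._+ (n N.+ 1) C 2) (nC1≡n (n N.+ 1)) ⟩
  (n N.+ 1) N.+ (n N.+ 1) C 2        ≡⟨ Nₚ.+-comm (n N.+ 1) _ ⟩
  (n N.+ 1) C 2 N.+ (n N.+ 1) ∎

χ-symmetric-pair : ∀ sa ta sb tb → (sa ≡ true → ta ≡ true) → (sb ≡ true → tb ≡ true) →
  χ ((sa ∧ tb) ∨ (ta ∧ sb)) ≡ χ ta * χ sb + χ sa * (χ tb - χ sb)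
χ-symmetric-pair true  false _     _     sa⇒ta _ with () ← sa⇒ta refl
χ-symmetric-pair _     _     true  false _ sb⇒tb with () ← sb⇒tb refl
χ-symmetric-pair true  true  true  true  _ _ = refl
χ-symmetric-pair true  true  false true  _ _ = refl
χ-symmetric-pair true  true  false false _ _ = refl
χ-symmetric-pair false true  true  true  _ _ = refl
χ-symmetric-pair false true  false true  _ _ = refl
χ-symmetric-pair false true  false false _ _ = refl
χ-symmetric-pair false false true  true  _ _ = refl
χ-symmetric-pair false false false true  _ _ = refl
χ-symmetric-pair false false false false _ _ = refl

χ-diagonal-pair : ∀ σ τ → (σ ≡ true → τ ≡ true) → χ ((σ ∧ τ) ∨ (τ ∧ σ)) ≡ χ σ
χ-diagonal-pair true  true  _ = refl
χ-diagonal-pair true  false σ⇒τ with () ← σ⇒τ refl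
χ-diagonal-pair false true  _ = refl
χ-diagonal-pair false false _ = refl

-- With a = S(h), b = T(h) and σ, τ the memberships of h + 1: the summands of the new index
-- h + 1 cancel the growth of S(h)T(h) and binom(S(h) + 1, 2) up to the diagonal pair {h+1, h+1}.
new-index-balance : ∀ σ τ → (σ ≡ true → τ ≡ true) → ∀ a b →
  + (if τ then a N.+ ind σ else 0)
    + (if σ then + (b N.+ ind τ) - + (a N.+ ind σ) else 0ℤ)
    - + (a N.+ ind σ) * + (b N.+ ind τ) + + ((a N.+ ind σ N.+ 1) C 2)
  ≡ + ((a N.+ 1) C 2) - + a * + b + χ σ
new-index-balance true false σ⇒τ _ _ with () ← σ⇒τ refl
new-index-balance false false _ a b rewrite Nₚ.+-identityʳ a | Nₚ.+-identityʳ b =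
  balance (+ a) (+ b) (+ ((a N.+ 1) C 2))
  where
  balance : ∀ a b c → 0ℤ + 0ℤ - a * b + c ≡ c - a * b + 0ℤ
  balance = solve-∀
new-index-balance false true _ a b rewrite Nₚ.+-identityʳ a =
  balance (+ a) (+ b) (+ ((a N.+ 1) C 2))
  where
  balance : ∀ a b c → a + 0ℤ - a * (b + + 1) + c ≡ c - a * b + 0ℤ
  balance = solve-∀
new-index-balance true true _ a b rewrite [n+2]C2≡[n+1]C2+[n+1] a =
  balance (+ a) (+ b) (+ ((a N.+ 1) C 2))
  where
  balance : ∀ a b c → (a + + 1) + ((b + + 1) - (a + + 1)) - (a + + 1) * (b + + 1) + (c + (a + + 1))
                      ≡ c - a * b + + 1
  balance = solve-∀

module PairCounting (S T : SeqSet) (oddS : OddSupported S) (oddT : OddSupported T)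
                    (S⊆T : ∀ n → S n ≡ true → T n ≡ true) where

  termT : ℕ → ℕ → ℕ
  termT x t = if T t then count S (x ∸ t) else 0

  termS : ℕ → ℕ → ℤ
  termS x s = if S s then + count T (x ∸ s) - + count S (x ∸ s) else 0ℤ

  A : ℕ → ℕ → ℤ
  A x q = + Σ≤ q (termT x) + ΣZ≤ q (termS x) - + count S q * + count T q + + ((count S q N.+ 1) C 2)

  Σg : ℕ → ℕ
  Σg k = Σ≤ k (λ k → g S T (2 N.* (k N.+ 1)))

  partner : ℕ → ℕ → ℕ
  partner h i = suc (suc (2 N.* h ∸ i))

  gainT gainS : ℕ → ℕ → ℤ
  gainT h i = χ (T i) * χ (S (partner h i))
  gainS h i = χ (S i) * (χ (T (partner h i)) - χ (S (partner h i)))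

  ≤-2* : ∀ {h i} → i ≤ h → i ≤ 2 N.* h
  ≤-2* {h} i≤h = Nₚ.≤-trans i≤h (Nₚ.m≤m+n h _)

  termT-step : ∀ h i → i ≤ h → + termT (2 N.* suc h) i ≡ + termT (2 N.* h) i + gainT h i
  termT-step h i i≤h with T i in Ti
  ... | false = refl
  ... | true = begin
    + count S (2 N.* suc h ∸ i)
      ≡⟨ cong (+_ ∘ count S) (2*[1+h]∸i≡2+[2*h∸i] h i (≤-2* i≤h)) ⟩
    + count S (partner h i)
      ≡⟨ cong +_ (count-skip S _ (no-odd-partner h oddS (oddT i Ti) (≤-2* i≤h))) ⟩
    + count S (2 N.* h ∸ i) + χ (S (partner h i))
      ≡⟨ cong (_+_ (+ count S (2 N.* h ∸ i))) (ℤₚ.*-identityˡ (χ (S (partner h i)))) ⟨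
    + count S (2 N.* h ∸ i) + + 1 * χ (S (partner h i)) ∎

  termS-step : ∀ h i → i ≤ h → termS (2 N.* suc h) i ≡ termS (2 N.* h) i + gainS h i
  termS-step h i i≤h with S i in Si
  ... | false = refl
  ... | true = begin
    + count T (2 N.* suc h ∸ i) - + count S (2 N.* suc h ∸ i)
      ≡⟨ cong (λ y → + count T y - + count S y) (2*[1+h]∸i≡2+[2*h∸i] h i (≤-2* i≤h)) ⟩
    + count T (partner h i) - + count S (partner h i)
      ≡⟨ cong₂ (λ u v → + u - + v) (count-skip T _ (no-partner oddT))
                                  (count-skip S _ (no-partner oddS)) ⟩
    + (count T y N.+ ind (T (partner h i))) - + (count S y N.+ ind (S (partner h i)))
      ≡⟨ shift (+ count T y) (+ count S y) (χ (T (partner h i))) (χ (S (partner h i))) ⟩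
    + count T y - + count S y + + 1 * (χ (T (partner h i)) - χ (S (partner h i))) ∎
    where
    y = 2 N.* h ∸ i
    no-partner : ∀ {P} → OddSupported P → P (suc y) ≡ false
    no-partner oddP = no-odd-partner h oddP (oddS i Si) (≤-2* i≤h)
    shift : ∀ a b c d → (a + c) - (b + d) ≡ (a - b) + + 1 * (c - d)
    shift = solve-∀

  pair-step : ∀ h i → i ≤ h →
    χ ((S i ∧ T (2 N.* suc h ∸ i)) ∨ (T i ∧ S (2 N.* suc h ∸ i))) ≡ gainT h i + gainS h i
  pair-step h i i≤h rewrite 2*[1+h]∸i≡2+[2*h∸i] h i (≤-2* i≤h) =
    χ-symmetric-pair (S i) (T i) (S (partner h i)) (T (partner h i)) (S⊆T i) (S⊆T _)

  ΣtermT-step : ∀ h → + Σ≤ h (termT (2 N.* suc h)) ≡ + Σ≤ h (termT (2 N.* h)) + ΣZ≤ h (gainT h)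
  ΣtermT-step h = begin
    + Σ≤ h (termT (2 N.* suc h))                   ≡⟨ +Σ≤≡ΣZ≤ h _ ⟩
    ΣZ≤ h (+_ ∘ termT (2 N.* suc h))               ≡⟨ ΣZ≤-cong h (termT-step h) ⟩
    ΣZ≤ h (λ i → + termT (2 N.* h) i + gainT h i)  ≡⟨ ΣZ≤-distrib-+ h _ _ ⟩
    ΣZ≤ h (+_ ∘ termT (2 N.* h)) + ΣZ≤ h (gainT h) ≡⟨ cong (_+ ΣZ≤ h (gainT h)) (+Σ≤≡ΣZ≤ h _) ⟨
    + Σ≤ h (termT (2 N.* h)) + ΣZ≤ h (gainT h) ∎

  ΣtermS-step : ∀ h → ΣZ≤ h (termS (2 N.* suc h)) ≡ ΣZ≤ h (termS (2 N.* h)) + ΣZ≤ h (gainS h)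
  ΣtermS-step h = trans (ΣZ≤-cong h (termS-step h)) (ΣZ≤-distrib-+ h _ _)

  g-step : ∀ h → + g S T (2 N.* suc h) ≡ ΣZ≤ h (gainT h) + ΣZ≤ h (gainS h) + χ (S (suc h))
  g-step h rewrite 2*n/2≡n (suc h) | 2*n∸n≡n (suc h) = cong₂ _+_
    (trans (+Σ≤≡ΣZ≤ h _) (trans (ΣZ≤-cong h (pair-step h)) (ΣZ≤-distrib-+ h _ _)))
    (χ-diagonal-pair (S (suc h)) (T (suc h)) (S⊆T (suc h)))

  A-step : ∀ h → A (2 N.* suc h) (suc h) ≡ A (2 N.* h) h + + g S T (2 N.* suc h)
  A-step h = begin
    A (2 N.* suc h) (suc h)
      ≡⟨ cong₂ (λ u v → u + v - P′ + B′) (cong₂ (λ u t → u + + t) (ΣtermT-step h) termT-top)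
                                         (cong₂ _+_ (ΣtermS-step h) termS-top) ⟩
    (X + G₁) + + termT′ + ((Y + G₂) + termS′) - P′ + B′
      ≡⟨ regroup X Y G₁ G₂ (+ termT′) termS′ P′ B′ ⟩
    X + Y + (G₁ + G₂) + (+ termT′ + termS′ - P′ + B′)
      ≡⟨ cong (_+_ (X + Y + (G₁ + G₂)))
              (new-index-balance (S (suc h)) (T (suc h)) (S⊆T (suc h)) (count S h) (count T h)) ⟩
    X + Y + (G₁ + G₂) + (+ ((count S h N.+ 1) C 2) - + count S h * + count T h + χ (S (suc h)))
      ≡⟨ regroup′ X Y (G₁ + G₂) _ (+ count S h * + count T h) _ ⟩
    A (2 N.* h) h + (G₁ + G₂ + χ (S (suc h)))
      ≡⟨ cong (_+_ (A (2 N.* h) h)) (g-step h) ⟨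
    A (2 N.* h) h + + g S T (2 N.* suc h) ∎
    where
    X = + Σ≤ h (termT (2 N.* h))
    Y = ΣZ≤ h (termS (2 N.* h))
    G₁ = ΣZ≤ h (gainT h)
    G₂ = ΣZ≤ h (gainS h)
    termT′ = if T (suc h) then count S (suc h) else 0
    termS′ = if S (suc h) then + count T (suc h) - + count S (suc h) else 0ℤ
    termT-top : termT (2 N.* suc h) (suc h) ≡ termT′
    termT-top = cong (λ y → if T (suc h) then count S y else 0) (2*n∸n≡n (suc h))
    termS-top : termS (2 N.* suc h) (suc h) ≡ termS′
    termS-top = cong (λ y → if S (suc h) then + count T y - + count S y else 0ℤ) (2*n∸n≡n (suc h))
    P′ = + count S (suc h) * + count T (suc h)
    B′ = + ((count S (suc h) N.+ 1) C 2)
    regroup : ∀ x y g₁ g₂ t s p b →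
      (x + g₁) + t + ((y + g₂) + s) - p + b ≡ x + y + (g₁ + g₂) + (t + s - p + b)
    regroup = solve-∀
    regroup′ : ∀ x y g b p c → x + y + g + (b - p + c) ≡ x + y - p + b + (g + c)
    regroup′ = solve-∀

  A-zero : A 0 0 ≡ 0ℤ
  A-zero rewrite odd-supported-0 oddS | odd-supported-0 oddT = refl

  A≡Σg : ∀ h → A (2 N.* suc h) (suc h) ≡ + Σg h
  A≡Σg zero = trans (A-step 0) (trans (cong (_+ + g S T 2) A-zero) (ℤₚ.+-identityˡ _))
  A≡Σg (suc h) = trans (A-step (suc h))
    (cong₂ _+_ (A≡Σg h) (cong (λ k → + g S T (2 N.* suc k)) (Nₚ.+-comm 1 h)))

  g≡A-Σg : ∀ k → + g S T (2 N.* suc (suc k)) ≡ A (2 N.* suc (suc k)) (suc (suc k)) - + Σg k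
  g≡A-Σg k = begin
    + g S T x                                    ≡⟨ cancel (+ Σg k) (+ g S T x) ⟩
    + Σg k + + g S T x - + Σg k                  ≡⟨ cong (λ a → a + + g S T x - + Σg k) (A≡Σg k) ⟨
    A (2 N.* suc k) (suc k) + + g S T x - + Σg k ≡⟨ cong (_- + Σg k) (A-step (suc k)) ⟨
    A x (suc (suc k)) - + Σg k ∎
    where
    x = 2 N.* suc (suc k)
    cancel : ∀ a b → b ≡ a + b - a
    cancel = solve-∀

corollary1 : (S T : SeqSet)
    → (∀ n → S n ≡ true → Odd n × 1 ≤ n)
    → (∀ n → T n ≡ true → Odd n × 1 ≤ n)
    → (∀ n → S n ≡ true → T n ≡ true)
    → (x : ℕ) → Even x → 4 ≤ x
    → + g S T x ≡
        + Σ≤ (x / 2) (λ t → if T t then count S (x ∸ t) else 0)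
        + ΣZ≤ (x / 2) (λ s → if S s then + count T (x ∸ s) - + count S (x ∸ s) else 0ℤ)
        - + count S (x / 2) * + count T (x / 2)
        + + ((Data.Nat._+_ (count S (x / 2)) 1) C 2)
        - + Σ≤ (x / 2 ∸ 2) (λ k → g S T (Data.Nat._*_ 2 (Data.Nat._+_ k 1)))
corollary1 S T _ _ _ .(2 N.* 1) (1 , refl) (s≤s (s≤s ()))
corollary1 S T S-odd T-odd S⊆T .(2 N.* suc (suc k)) (suc (suc k) , refl) _
  = trans (g≡A-Σg k) (cong (λ q → A x q - + Σg (q ∸ 2)) (sym (2*n/2≡n (suc (suc k)))))
  where
  open PairCounting S T (λ n → proj₁ ∘ S-odd n) (λ n → proj₁ ∘ T-odd n) S⊆T
  x = 2 N.* suc (suc k)
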